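{- Let $n=\prod_i p_i^{r_i}$ be a composite positive integer, with distinct primes $p_i$. Let $f\in\mathbb{Z}[x]$ be monic of degree 2 with discriminant $\Delta$, and suppose $\left(\frac{\Delta}{n}\right)=1$. Then $n$ is a degree-2 Frobenius pseudoprime with respect to $f$ if and only if both of the following hold: (1) $\Delta$ is a unit modulo $n$, and $0$ is not a root of $f$ modulo $p_i$ for every $i$; (2) $\mathrm{gcmd}(x^n-x,f(x))=f(x)$ modulo $p_i^{r_i}$ for every $i$.
   Context: For a positive integer $m$ and monic $g_1,g_2,h\in(\mathbb{Z}/m\mathbb{Z})[x]$, "$\mathrm{gcmd}(g_1,g_2)=h$ modulo $m$" means that the ideal generated by $g_1,g_2$ in $(\mathbb{Z}/m\mathbb{Z})[x]$ equals the ideal generated by $h$. A composite $n$ is a degree-2 Frobenius pseudoprime with respect to a monic quadratic $f\in\mathbb{Z}[x]$ with discriminant $\Delta$ if all of the following hold: (1) $\gcd(n,f(0)\Delta)=1$; (2) modulo $n$, the polynomials $F_1=\mathrm{gcmd}(x^n-x,f)$, $f_1=f/F_1$, $F_2=\mathrm{gcmd}(x^{n^2}-x,f_1)$ and $f_2=f_1/F_2$ all exist, and $f_2=1$; (3) $F_2(x)\mid F_2(x^n)$ modulo $n$; (4) $(-1)^{\deg(F_2)/2}=\left(\frac{\Delta}{n}\right)$ (Jacobi symbol). -}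

module Defs where

open import Data.Nat as ℕ using (ℕ; zero; suc)
open import Data.Nat.Divisibility as ℕD using (_∣?_)
open import Data.Nat.DivMod as ℕDM using ()
open import Data.Integer as ℤ using (ℤ; +_; -[1+_]; ∣_∣)
open import Data.Integer.Divisibility as ℤD using ()
open import Data.Integer.DivMod using (_%ℕ_)
open import Data.List using (List; []; _∷_; replicate; _++_; upTo; foldr)
open import Data.Bool.ListAction using (any)
open import Data.Bool using (Bool; true; false; if_then_else_)
open import Data.Product using (Σ; ∃; _×_; _,_)
open import Relation.Nullary using (¬_; yes; no; does)
open import Relation.Binary.PropositionalEquality using (_≡_)
open import Data.Nat.Primality using (Composite)
open import Data.Nat.Coprimality using (Coprime)

-- Polynomials with integer coefficients, as coefficient lists
-- (constant term first).  A polynomial in (ℤ/mℤ)[x] is represented by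
-- any integer lift; equality in (ℤ/mℤ)[x] is coefficientwise congruence.

infixl 6 _⊕_ _⊖_
infixl 7 _⊗_
infix 4 _≈_[mod_] _≡ᶻ_[mod_] _∣ₚ_[mod_]

Poly : Set
Poly = List ℤ

coeff : Poly → ℕ → ℤ
coeff []       _       = + 0
coeff (a ∷ _)  zero    = a
coeff (_ ∷ as) (suc i) = coeff as i

_⊕_ : Poly → Poly → Poly
[]       ⊕ q        = q
(a ∷ p)  ⊕ []       = a ∷ p
(a ∷ p)  ⊕ (b ∷ q)  = (a ℤ.+ b) ∷ (p ⊕ q)

scale : ℤ → Poly → Poly
scale c []       = []
scale c (a ∷ p)  = (c ℤ.* a) ∷ scale c p

neg : Poly → Poly
neg = scale (ℤ.- (+ 1))

_⊖_ : Poly → Poly → Poly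
p ⊖ q = p ⊕ neg q

_⊗_ : Poly → Poly → Poly
[]      ⊗ q = []
(a ∷ p) ⊗ q = scale a q ⊕ (+ 0 ∷ (p ⊗ q))

one : Poly
one = + 1 ∷ []

xpow : ℕ → Poly
xpow k = replicate k (+ 0) ++ (+ 1 ∷ [])

compose : Poly → Poly → Poly
compose []      q = []
compose (a ∷ p) q = (a ∷ []) ⊕ (q ⊗ compose p q)

quad : ℤ → ℤ → Poly
quad b c = c ∷ b ∷ + 1 ∷ []

disc : ℤ → ℤ → ℤ
disc b c = b ℤ.* b ℤ.- (+ 4) ℤ.* c

_≡ᶻ_[mod_] : ℤ → ℤ → ℕ → Set
a ≡ᶻ b [mod m ] = (+ m) ℤD.∣ (a ℤ.- b)

_≈_[mod_] : Poly → Poly → ℕ → Set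
p ≈ q [mod m ] = ∀ i → coeff p i ≡ᶻ coeff q i [mod m ]

MonicDeg : ℕ → Poly → ℕ → Set
MonicDeg m h d = (coeff h d ≡ᶻ + 1 [mod m ]) × (∀ i → d ℕ.< i → coeff h i ≡ᶻ + 0 [mod m ])

Monic : ℕ → Poly → Set
Monic m h = ∃ λ d → MonicDeg m h d

_∣ₚ_[mod_] : Poly → Poly → ℕ → Set
g ∣ₚ h [mod m ] = ∃ λ q → h ≈ q ⊗ g [mod m ]

-- gcmd(g₁,g₂) = h modulo m : h is monic and the ideal (g₁,g₂) equals
-- the ideal (h) in (ℤ/mℤ)[x], i.e. h ∈ (g₁,g₂) and g₁,g₂ ∈ (h).
Gcmd : ℕ → Poly → Poly → Poly → Set
Gcmd m g₁ g₂ h =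
  Monic m h ×
  (∃ λ a → ∃ λ b → (a ⊗ g₁) ⊕ (b ⊗ g₂) ≈ h [mod m ]) ×
  (h ∣ₚ g₁ [mod m ]) × (h ∣ₚ g₂ [mod m ])

IsQuot : ℕ → Poly → Poly → Poly → Set
IsQuot m f g q = f ≈ g ⊗ q [mod m ]

legendre : ℤ → ℕ → ℤ
legendre a zero = + 0
legendre a (suc k) with a %ℕ suc k
... | zero = + 0
... | r@(suc _) =
  if any (λ x → does ((x ℕ.* x) ℕDM.% suc k ℕ.≟ r)) (upTo (suc k))
  then + 1 else -[1+ 0 ]

minDivAux : ℕ → ℕ → ℕ → ℕ
minDivAux zero    d n = n
minDivAux (suc k) d n = if does (d ∣? n) then d else minDivAux k (suc d) n

minDiv : ℕ → ℕ
minDiv n = minDivAux n 2 n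

divN : ℕ → ℕ → ℕ
divN n zero    = 0
divN n (suc m) = n ℕDM./ suc m

factorsAux : ℕ → ℕ → List ℕ
factorsAux zero    n                = []
factorsAux (suc k) zero             = []
factorsAux (suc k) (suc zero)       = []
factorsAux (suc k) n@(suc (suc _))  = minDiv n ∷ factorsAux k (divN n (minDiv n))

primeFactors : ℕ → List ℕ
primeFactors n = factorsAux n n

-- Jacobi symbol (a/n) = ∏ over the prime factorisation n = p₁⋯pₖ of (a/pᵢ)
-- (the Jacobi symbol is meant for odd n)
jacobi : ℤ → ℕ → ℤ
jacobi a n = foldr (λ p s → legendre a p ℤ.* s) (+ 1) (primeFactors n)

FrobPsp2 : ℕ → ℤ → ℤ → Set
FrobPsp2 n b c =
  Composite n ×
  Coprime n ∣ c ℤ.* disc b c ∣ ×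
  (∃ λ F₁ → ∃ λ f₁ → ∃ λ F₂ → ∃ λ f₂ →
     Gcmd n (xpow n ⊖ xpow 1) (quad b c) F₁ ×
     IsQuot n (quad b c) F₁ f₁ ×
     Gcmd n (xpow (n ℕ.* n) ⊖ xpow 1) f₁ F₂ ×
     IsQuot n f₁ F₂ f₂ ×
     (f₂ ≈ one [mod n ]) ×
     (F₂ ∣ₚ compose F₂ (xpow n) [mod n ]) ×
     (∃ λ k → MonicDeg n F₂ (2 ℕ.* k) × (-[1+ 0 ] ℤ.^ k ≡ jacobi (disc b c) n)))

-- Since (Δ/n) = 1, the degree condition makes deg F₂ = 2k with (−1)^k = 1, so k = 0 or k ≥ 2;
-- k ≥ 2 is impossible because F₁F₂ ≡ f has degree 2.  Hence F₂ = f₁ = 1 and F₁ = f: a Frobenius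
-- pseudoprime is exactly an n with gcd(n, cΔ) = 1 and f ∣ xⁿ − x modulo n (the remaining
-- conditions then hold for F₁ = f, f₁ = F₂ = f₂ = 1).  Division by the monic f leaves a remainder
-- r₀ + r₁x with integer coefficients, and f ∣ g modulo m iff m divides r₀ and r₁; so divisibility
-- modulo n is equivalent to divisibility modulo every exact prime power pʳ ∥ n.  Finally
-- gcd(n, cΔ) = 1 splits into Δ being a unit modulo n and c ≢ 0 modulo every prime p ∣ n.
module Submission where

open import Defs
open import Data.Empty using (⊥-elim)
open import Data.Integer as ℤ using (ℤ; +_; -[1+_]; _*_; _+_; _-_; -_)
import Data.Integer.Divisibility.Signed as ℤ
import Data.Integer.Properties as ℤ
open import Data.Integer.Tactic.RingSolver using (solve-∀)
open import Data.List using ([]; _∷_)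
open import Data.List.Relation.Unary.All using (_∷_)
open import Data.Nat as ℕ using (ℕ; zero; suc; _^_)
open import Data.Nat.Coprimality using (Coprime; coprime-Bézout)
open import Data.Nat.Divisibility as ℕ using (_∣_)
open import Data.Nat.GCD as ℕ using (module Bézout)
open import Data.Nat.Induction using (<-rec)
open import Data.Nat.ListAction using (product)
open import Data.Nat.Primality
  using (Prime; Composite; composite⇒nonZero; composite⇒nonTrivial; prime⇒nonTrivial; prime[2]; euclidsLemma)
open import Data.Nat.Primality.Factorisation using (factorise)
import Data.Nat.Properties as ℕ
open import Data.Product using (∃; _×_; _,_; proj₁; proj₂; map₂)
open import Data.Product.Function.NonDependent.Propositional using (_×-⇔_)
open import Data.Product.Relation.Binary.Pointwise.NonDependent using (Pointwise)
open import Data.Sum using ([_,_]′)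
open import Function.Bundles using (_⇔_; mk⇔; Equivalence)
open import Function.Construct.Composition using (_⇔-∘_)
open import Relation.Binary.Bundles using (Setoid)
open import Relation.Binary.PropositionalEquality as ≡
  using (_≡_; _≢_; _≗_; refl; cong; cong₂; subst; subst₂)
import Relation.Binary.Reasoning.Setoid as SetoidReasoning
open import Relation.Nullary using (¬_; yes; no)

infix 4 _≡_[mod_] _≋_[mod_] _≡²_[mod_]

-- Records rather than the relations of Defs, so that the related terms can be inferred from the type.
record _≡_[mod_] (a b : ℤ) (m : ℕ) : Set where
  constructor ≡ᶻ⇒≡
  field ≡⇒≡ᶻ : a ≡ᶻ b [mod m ]
open _≡_[mod_] public

module _ {m : ℕ} where

  private
    toSigned : ∀ {a b} → a ≡ b [mod m ] → + m ℤ.∣ a - b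
    toSigned {a} {b} (≡ᶻ⇒≡ m∣a-b) = ℤ.∣ᵤ⇒∣ {+ m} {a - b} m∣a-b

    fromSigned : ∀ {a b} → + m ℤ.∣ a - b → a ≡ b [mod m ]
    fromSigned {a} {b} m∣a-b = ≡ᶻ⇒≡ (ℤ.∣⇒∣ᵤ {+ m} {a - b} m∣a-b)

    via : ∀ {a b x} → x ≡ a - b → + m ℤ.∣ x → a ≡ b [mod m ]
    via refl = fromSigned

  ≡ₘ-intro : ∀ {a b} k → a - b ≡ k * + m → a ≡ b [mod m ]
  ≡ₘ-intro k a-b≡k*m = fromSigned (ℤ.divides k a-b≡k*m)

  ≡⇒≡ₘ : ∀ {a b} → a ≡ b → a ≡ b [mod m ]
  ≡⇒≡ₘ {a} refl = ≡ₘ-intro (+ 0) (ℤ.+-inverseʳ a)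

  ≡ₘ-refl : ∀ {a} → a ≡ a [mod m ]
  ≡ₘ-refl = ≡⇒≡ₘ refl

  ≡ₘ-sym : ∀ {a b} → a ≡ b [mod m ] → b ≡ a [mod m ]
  ≡ₘ-sym {a} {b} a≡b = via (identity a b) (ℤ.∣m⇒∣-m (toSigned a≡b))
    where
    identity : ∀ a b → - (a - b) ≡ b - a
    identity = solve-∀

  ≡ₘ-trans : ∀ {a b c} → a ≡ b [mod m ] → b ≡ c [mod m ] → a ≡ c [mod m ]
  ≡ₘ-trans {a} {b} {c} a≡b b≡c = via (identity a b c) (ℤ.∣m∣n⇒∣m+n (toSigned a≡b) (toSigned b≡c))
    where
    identity : ∀ a b c → (a - b) + (b - c) ≡ a - c
    identity = solve-∀

  +-congₘ : ∀ {a b c d} → a ≡ b [mod m ] → c ≡ d [mod m ] → a + c ≡ b + d [mod m ]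
  +-congₘ {a} {b} {c} {d} a≡b c≡d = via (identity a b c d) (ℤ.∣m∣n⇒∣m+n (toSigned a≡b) (toSigned c≡d))
    where
    identity : ∀ a b c d → (a - b) + (c - d) ≡ (a + c) - (b + d)
    identity = solve-∀

  *-congₘ : ∀ {a b c d} → a ≡ b [mod m ] → c ≡ d [mod m ] → a * c ≡ b * d [mod m ]
  *-congₘ {a} {b} {c} {d} a≡b c≡d =
    via (identity a b c d) (ℤ.∣m∣n⇒∣m+n (ℤ.∣m⇒∣m*n c (toSigned a≡b)) (ℤ.∣n⇒∣m*n b (toSigned c≡d)))
    where
    identity : ∀ a b c d → (a - b) * c + b * (c - d) ≡ a * c - b * d
    identity = solve-∀

  -‿congₘ : ∀ {a b} → a ≡ b [mod m ] → - a ≡ - b [mod m ]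
  -‿congₘ {a} {b} a≡b = via (identity a b) (ℤ.∣m⇒∣-m (toSigned a≡b))
    where
    identity : ∀ a b → - (a - b) ≡ - a - - b
    identity = solve-∀

≡ₘ-setoid : ℕ → Setoid _ _
≡ₘ-setoid m = record
  { Carrier       = ℤ
  ; _≈_           = λ a b → a ≡ b [mod m ]
  ; isEquivalence = record { refl = ≡ₘ-refl ; sym = ≡ₘ-sym ; trans = ≡ₘ-trans }
  }

≡ₘ-weaken : ∀ {d m a b} → d ∣ m → a ≡ b [mod m ] → a ≡ b [mod d ]
≡ₘ-weaken d∣m (≡ᶻ⇒≡ m∣a-b) = ≡ᶻ⇒≡ (ℕ.∣-trans d∣m m∣a-b)

≡0ₘ⇔∣ : ∀ {m} a → a ≡ + 0 [mod m ] ⇔ m ∣ ℤ.∣ a ∣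
≡0ₘ⇔∣ {m} a = mk⇔ (λ a≡0 → subst (λ z → m ∣ ℤ.∣ z ∣) (ℤ.+-identityʳ a) (≡⇒≡ᶻ a≡0))
                   (λ m∣a → ≡ᶻ⇒≡ (subst (λ z → m ∣ ℤ.∣ z ∣) (≡.sym (ℤ.+-identityʳ a)) m∣a))

0≡1⇒m≡1 : ∀ {m} → + 0 ≡ + 1 [mod m ] → m ≡ 1
0≡1⇒m≡1 0≡1 = ℕ.∣1⇒≡1 (≡⇒≡ᶻ 0≡1)

coeff-⊕ : ∀ p q i → coeff (p ⊕ q) i ≡ coeff p i + coeff q i
coeff-⊕ []      q       i       = ≡.sym (ℤ.+-identityˡ (coeff q i))
coeff-⊕ (a ∷ p) []      i       = ≡.sym (ℤ.+-identityʳ (coeff (a ∷ p) i))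
coeff-⊕ (a ∷ p) (b ∷ q) zero    = refl
coeff-⊕ (a ∷ p) (b ∷ q) (suc i) = coeff-⊕ p q i

coeff-scale : ∀ a p i → coeff (scale a p) i ≡ a * coeff p i
coeff-scale a []      i       = ≡.sym (ℤ.*-zeroʳ a)
coeff-scale a (b ∷ p) zero    = refl
coeff-scale a (b ∷ p) (suc i) = coeff-scale a p i

coeff-∷⊗ : ∀ a p q i → coeff ((a ∷ p) ⊗ q) i ≡ a * coeff q i + coeff (+ 0 ∷ p ⊗ q) i
coeff-∷⊗ a p q i = ≡.trans (coeff-⊕ (scale a q) (+ 0 ∷ p ⊗ q) i) (cong (_+ _) (coeff-scale a q i))

record _≋_[mod_] (p q : Poly) (m : ℕ) : Set where
  constructor coeffwise
  field coeff-≡ₘ : ∀ i → coeff p i ≡ coeff q i [mod m ]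
open _≋_[mod_] public

module _ {m : ℕ} where

  ≋⇒≈ : ∀ {p q} → p ≋ q [mod m ] → p ≈ q [mod m ]
  ≋⇒≈ p≋q i = ≡⇒≡ᶻ (coeff-≡ₘ p≋q i)

  ≈⇒≋ : ∀ {p q} → p ≈ q [mod m ] → p ≋ q [mod m ]
  ≈⇒≋ p≈q = coeffwise λ i → ≡ᶻ⇒≡ (p≈q i)

  ≗⇒≋ : ∀ {p q} → coeff p ≗ coeff q → p ≋ q [mod m ]
  ≗⇒≋ p≗q = coeffwise λ i → ≡⇒≡ₘ (p≗q i)

  ≋-refl : ∀ {p} → p ≋ p [mod m ]
  ≋-refl = coeffwise λ _ → ≡ₘ-refl

  ≋-sym : ∀ {p q} → p ≋ q [mod m ] → q ≋ p [mod m ]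
  ≋-sym p≋q = coeffwise λ i → ≡ₘ-sym (coeff-≡ₘ p≋q i)

  ≋-trans : ∀ {p q r} → p ≋ q [mod m ] → q ≋ r [mod m ] → p ≋ r [mod m ]
  ≋-trans p≋q q≋r = coeffwise λ i → ≡ₘ-trans (coeff-≡ₘ p≋q i) (coeff-≡ₘ q≋r i)

  ∷-zeroₘ : ∀ {p} → p ≋ [] [mod m ] → + 0 ∷ p ≋ [] [mod m ]
  ∷-zeroₘ p≋0 = coeffwise λ { zero → ≡ₘ-refl ; (suc i) → coeff-≡ₘ p≋0 i }

  ∷-congₘ : ∀ {a b p q} → a ≡ b [mod m ] → p ≋ q [mod m ] → a ∷ p ≋ b ∷ q [mod m ]
  ∷-congₘ a≡b p≋q = coeffwise λ { zero → a≡b ; (suc i) → coeff-≡ₘ p≋q i }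

  ⊕-congₘ : ∀ {p p′ q q′} → p ≋ p′ [mod m ] → q ≋ q′ [mod m ] → p ⊕ q ≋ p′ ⊕ q′ [mod m ]
  ⊕-congₘ {p} {p′} {q} {q′} p≋p′ q≋q′ = coeffwise λ i →
    subst₂ (_≡_[mod m ]) (≡.sym (coeff-⊕ p q i)) (≡.sym (coeff-⊕ p′ q′ i))
      (+-congₘ (coeff-≡ₘ p≋p′ i) (coeff-≡ₘ q≋q′ i))

  scale-congₘ : ∀ a {p q} → p ≋ q [mod m ] → scale a p ≋ scale a q [mod m ]
  scale-congₘ a {p} {q} p≋q = coeffwise λ i →
    subst₂ (_≡_[mod m ]) (≡.sym (coeff-scale a p i)) (≡.sym (coeff-scale a q i))
      (*-congₘ (≡ₘ-refl {a = a}) (coeff-≡ₘ p≋q i))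

  ⊗-congʳₘ : ∀ p {q q′} → q ≋ q′ [mod m ] → p ⊗ q ≋ p ⊗ q′ [mod m ]
  ⊗-congʳₘ []      q≋q′ = ≗⇒≋ (λ _ → refl)
  ⊗-congʳₘ (a ∷ p) q≋q′ = ⊕-congₘ (scale-congₘ a q≋q′) (∷-congₘ ≡ₘ-refl (⊗-congʳₘ p q≋q′))

  ⊗-zeroˡₘ : ∀ p {q} → p ≋ [] [mod m ] → p ⊗ q ≋ [] [mod m ]
  ⊗-zeroˡₘ []          _   = ≋-refl
  ⊗-zeroˡₘ (a ∷ p) {q} p≋0 = coeffwise λ i → begin
    coeff ((a ∷ p) ⊗ q) i                  ≡⟨ coeff-∷⊗ a p q i ⟩
    a * coeff q i + coeff (+ 0 ∷ p ⊗ q) i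
      ≈⟨ +-congₘ (*-congₘ (coeff-≡ₘ p≋0 0) ≡ₘ-refl)
                 (coeff-≡ₘ (∷-zeroₘ (⊗-zeroˡₘ p (coeffwise λ j → coeff-≡ₘ p≋0 (suc j)))) i) ⟩
    + 0                                    ∎
    where open SetoidReasoning (≡ₘ-setoid m)

  leading-⊗ : ∀ {d e} p q → MonicDeg m p d → MonicDeg m q e → coeff (p ⊗ q) (d ℕ.+ e) ≡ + 1 [mod m ]
  leading-⊗ []      q (lead , _) _ = ≡ᶻ⇒≡ lead
  leading-⊗ {zero} {e} (a ∷ p) q (a≡1 , above) (q-lead , _) = begin
    coeff ((a ∷ p) ⊗ q) e                  ≡⟨ coeff-∷⊗ a p q e ⟩
    a * coeff q e + coeff (+ 0 ∷ p ⊗ q) e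
      ≈⟨ +-congₘ (*-congₘ (≡ᶻ⇒≡ {a} a≡1) (≡ᶻ⇒≡ {coeff q e} q-lead))
                 (coeff-≡ₘ (∷-zeroₘ (⊗-zeroˡₘ p (coeffwise λ j → ≡ᶻ⇒≡ (above (suc j) (ℕ.s≤s ℕ.z≤n))))) e) ⟩
    + 1                                    ∎
    where open SetoidReasoning (≡ₘ-setoid m)
  leading-⊗ {suc d} {e} (a ∷ p) q (lead , above) q-monic@(_ , q-above) = begin
    coeff ((a ∷ p) ⊗ q) (suc (d ℕ.+ e))                    ≡⟨ coeff-∷⊗ a p q (suc (d ℕ.+ e)) ⟩
    a * coeff q (suc (d ℕ.+ e)) + coeff (p ⊗ q) (d ℕ.+ e)
      ≈⟨ +-congₘ (*-congₘ (≡ₘ-refl {a = a}) (≡ᶻ⇒≡ {coeff q (suc (d ℕ.+ e))} (q-above _ (ℕ.s≤s (ℕ.m≤n+m e d)))))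
                 (leading-⊗ p q (lead , λ i d<i → above (suc i) (ℕ.s≤s d<i)) q-monic) ⟩
    a * + 0 + + 1                                          ≡⟨ cong (_+ + 1) (ℤ.*-zeroʳ a) ⟩
    + 1                                                    ∎
    where open SetoidReasoning (≡ₘ-setoid m)

  monic₀⇒≋one : ∀ {p} → MonicDeg m p 0 → p ≋ one [mod m ]
  monic₀⇒≋one (lead , above) = coeffwise λ
    { zero    → ≡ᶻ⇒≡ lead
    ; (suc i) → ≡ᶻ⇒≡ (above (suc i) (ℕ.s≤s ℕ.z≤n))
    }

  ⊗-identityʳ : ∀ p → p ⊗ one ≋ p [mod m ]
  ⊗-identityʳ p = ≗⇒≋ (coeff-⊗one p)
    where
    coeff-⊗one : ∀ p → coeff (p ⊗ one) ≗ coeff p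
    coeff-⊗one []      i       = refl
    coeff-⊗one (a ∷ p) zero    = ≡.trans (ℤ.+-identityʳ (a * + 1)) (ℤ.*-identityʳ a)
    coeff-⊗one (a ∷ p) (suc i) = coeff-⊗one p i

  ⊗-identityˡ : ∀ p → one ⊗ p ≋ p [mod m ]
  ⊗-identityˡ p = ≗⇒≋ λ i → begin
    coeff (one ⊗ p) i                          ≡⟨ coeff-∷⊗ (+ 1) [] p i ⟩
    + 1 * coeff p i + coeff (+ 0 ∷ []) i       ≡⟨ cong₂ _+_ (ℤ.*-identityˡ (coeff p i)) (coeff-0∷[] i) ⟩
    coeff p i + + 0                            ≡⟨ ℤ.+-identityʳ (coeff p i) ⟩
    coeff p i                                  ∎
    where
    open ≡.≡-Reasoning
    coeff-0∷[] : ∀ i → coeff (+ 0 ∷ []) i ≡ + 0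
    coeff-0∷[] zero    = refl
    coeff-0∷[] (suc i) = refl

  quad-monic : ∀ b c → MonicDeg m (quad b c) 2
  quad-monic b c = ≡⇒≡ᶻ (≡ₘ-refl {a = + 1}) , vanishes
    where
    vanishes : ∀ i → 2 ℕ.< i → coeff (quad b c) i ≡ᶻ + 0 [mod m ]
    vanishes (suc zero)          (ℕ.s≤s ())
    vanishes (suc (suc zero))    (ℕ.s≤s (ℕ.s≤s ()))
    vanishes (suc (suc (suc i))) _ = ≡⇒≡ᶻ (≡ₘ-refl {a = + 0})

  one-monic : MonicDeg m one 0
  one-monic = ≡⇒≡ᶻ (≡ₘ-refl {a = + 1}) , λ { (suc i) _ → ≡⇒≡ᶻ (≡ₘ-refl {a = + 0}) }

  ∣ₚ-weaken : ∀ {d g h} → d ∣ m → h ∣ₚ g [mod m ] → h ∣ₚ g [mod d ]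
  ∣ₚ-weaken d∣m (q , g≈q⊗h) = q , λ i → ℕ.∣-trans d∣m (g≈q⊗h i)

  one-∣ₚ : ∀ g → one ∣ₚ g [mod m ]
  one-∣ₚ g = g , ≋⇒≈ (≋-sym (⊗-identityʳ g))

  Gcmd-self : ∀ {g h} → Monic m h → h ∣ₚ g [mod m ] → Gcmd m g h h
  Gcmd-self {h = h} monic h∣g =
    monic , ([] , one , ≋⇒≈ (⊗-identityˡ h)) , h∣g , (one , ≋⇒≈ (≋-sym (⊗-identityˡ h)))

≋-setoid : ℕ → Setoid _ _
≋-setoid m = record
  { Carrier       = Poly
  ; _≈_           = λ p q → p ≋ q [mod m ]
  ; isEquivalence = record { refl = ≋-refl ; sym = ≋-sym ; trans = ≋-trans }
  }

_≡²_[mod_] : ℤ × ℤ → ℤ × ℤ → ℕ → Set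
r ≡² s [mod m ] = Pointwise (_≡_[mod m ]) (_≡_[mod m ]) r s

module _ (b c : ℤ) where

  -- A pair (r₀ , r₁) stands for r₀ + r₁ x; horner a r is a + x (r₀ + r₁ x) reduced by x² = - b x - c.
  horner : ℤ → ℤ × ℤ → ℤ × ℤ
  horner a r = a - c * proj₂ r , proj₁ r - b * proj₂ r

  remainder : Poly → ℤ × ℤ
  remainder []      = + 0 , + 0
  remainder (a ∷ p) = horner a (remainder p)

  quotient : Poly → Poly
  quotient []      = []
  quotient (a ∷ p) = proj₂ (remainder p) ∷ quotient p

linear : ℤ × ℤ → Poly
linear r = proj₁ r ∷ proj₂ r ∷ []

module _ {b c : ℤ} where

  private
    f = quad b c

  x*linear : ∀ a r j →
    coeff (linear r) j ≡ proj₂ r * coeff f (suc j) + coeff (linear (horner b c a r)) (suc j)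
  x*linear a (r₀ , r₁) zero          = identity r₀ r₁ b
    where
    identity : ∀ r₀ r₁ b → r₀ ≡ r₁ * b + (r₀ - b * r₁)
    identity = solve-∀
  x*linear a (r₀ , r₁) (suc zero)    = identity r₁
    where
    identity : ∀ r₁ → r₁ ≡ r₁ * + 1 + + 0
    identity = solve-∀
  x*linear a (r₀ , r₁) (suc (suc j)) = identity r₁
    where
    identity : ∀ r₁ → + 0 ≡ r₁ * + 0 + + 0
    identity = solve-∀

  division : ∀ p i → coeff p i ≡ coeff (quotient b c p ⊗ f) i + coeff (linear (remainder b c p)) i
  division []      zero          = refl
  division []      (suc zero)    = refl
  division []      (suc (suc i)) = refl
  division (a ∷ p) zero          = begin
    a                                   ≡⟨ identity a r₁ c ⟩
    (r₁ * c + + 0) + (a - c * r₁)       ≡⟨ cong (_+ (a - c * r₁)) (coeff-∷⊗ r₁ Q f zero) ⟨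
    coeff ((r₁ ∷ Q) ⊗ f) zero + (a - c * r₁) ∎
    where
    open ≡.≡-Reasoning
    r₁ = proj₂ (remainder b c p)
    Q  = quotient b c p
    identity : ∀ a r₁ c → a ≡ (r₁ * c + + 0) + (a - c * r₁)
    identity = solve-∀
  division (a ∷ p) (suc j)       = begin
    coeff p j                                             ≡⟨ division p j ⟩
    coeff (Q ⊗ f) j + coeff (linear r) j                  ≡⟨ cong (λ z → coeff (Q ⊗ f) j + z) (x*linear a r j) ⟩
    coeff (Q ⊗ f) j + (proj₂ r * coeff f (suc j) + H)     ≡⟨ identity (coeff (Q ⊗ f) j) (proj₂ r * coeff f (suc j)) H ⟩
    (proj₂ r * coeff f (suc j) + coeff (Q ⊗ f) j) + H     ≡⟨ cong (_+ H) (coeff-∷⊗ (proj₂ r) Q f (suc j)) ⟨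
    coeff ((proj₂ r ∷ Q) ⊗ f) (suc j) + H                 ∎
    where
    open ≡.≡-Reasoning
    r = remainder b c p
    Q = quotient b c p
    H = coeff (linear (horner b c a r)) (suc j)
    identity : ∀ x y z → x + (y + z) ≡ (y + x) + z
    identity = solve-∀

  private
    infixl 6 _⊞_
    infixl 7 _⊡_

    _⊞_ : ℤ × ℤ → ℤ × ℤ → ℤ × ℤ
    r ⊞ s = proj₁ r + proj₁ s , proj₂ r + proj₂ s

    _⊡_ : ℤ → ℤ × ℤ → ℤ × ℤ
    k ⊡ r = k * proj₁ r , k * proj₂ r

  remainder-⊕ : ∀ p q → remainder b c (p ⊕ q) ≡ remainder b c p ⊞ remainder b c q
  remainder-⊕ []      q        = ≡.sym (cong₂ _,_ (ℤ.+-identityˡ _) (ℤ.+-identityˡ _))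
  remainder-⊕ (a ∷ p) []       = ≡.sym (cong₂ _,_ (ℤ.+-identityʳ _) (ℤ.+-identityʳ _))
  remainder-⊕ (a ∷ p) (a′ ∷ q) = ≡.trans (cong (horner b c (a + a′)) (remainder-⊕ p q))
    (cong₂ _,_ (identity₁ a a′ c (proj₂ (remainder b c p)) (proj₂ (remainder b c q)))
               (identity₂ b (proj₁ (remainder b c p)) (proj₁ (remainder b c q))
                            (proj₂ (remainder b c p)) (proj₂ (remainder b c q))))
    where
    identity₁ : ∀ a a′ c r s → (a + a′) - c * (r + s) ≡ (a - c * r) + (a′ - c * s)
    identity₁ = solve-∀
    identity₂ : ∀ b r₀ s₀ r₁ s₁ → (r₀ + s₀) - b * (r₁ + s₁) ≡ (r₀ - b * r₁) + (s₀ - b * s₁)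
    identity₂ = solve-∀

  remainder-scale : ∀ k p → remainder b c (scale k p) ≡ k ⊡ remainder b c p
  remainder-scale k []      = ≡.sym (cong₂ _,_ (ℤ.*-zeroʳ k) (ℤ.*-zeroʳ k))
  remainder-scale k (a ∷ p) = ≡.trans (cong (horner b c (k * a)) (remainder-scale k p))
    (cong₂ _,_ (identity₁ k a c (proj₂ (remainder b c p)))
               (identity₂ k b (proj₁ (remainder b c p)) (proj₂ (remainder b c p))))
    where
    identity₁ : ∀ k a c r → k * a - c * (k * r) ≡ k * (a - c * r)
    identity₁ = solve-∀
    identity₂ : ∀ k b r₀ r₁ → k * r₀ - b * (k * r₁) ≡ k * (r₀ - b * r₁)
    identity₂ = solve-∀

  remainder-quad : remainder b c f ≡ (+ 0 , + 0)
  remainder-quad = cong₂ _,_ (identity₁ b c) (identity₂ b c)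
    where
    identity₁ : ∀ b c → c - c * ((+ 1 - c * + 0) - b * (+ 0 - b * + 0)) ≡ + 0
    identity₁ = solve-∀
    identity₂ : ∀ b c → (b - c * (+ 0 - b * + 0)) - b * ((+ 1 - c * + 0) - b * (+ 0 - b * + 0)) ≡ + 0
    identity₂ = solve-∀

  remainder-⊗quad : ∀ g → remainder b c (g ⊗ f) ≡ (+ 0 , + 0)
  remainder-⊗quad []      = refl
  remainder-⊗quad (a ∷ g) = begin
    remainder b c (scale a f ⊕ (+ 0 ∷ g ⊗ f))                        ≡⟨ remainder-⊕ (scale a f) (+ 0 ∷ g ⊗ f) ⟩
    remainder b c (scale a f) ⊞ horner b c (+ 0) (remainder b c (g ⊗ f))
      ≡⟨ cong₂ _⊞_ (≡.trans (remainder-scale a f) (cong (a ⊡_) remainder-quad))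
                   (cong (horner b c (+ 0)) (remainder-⊗quad g)) ⟩
    a ⊡ (+ 0 , + 0) ⊞ horner b c (+ 0) (+ 0 , + 0)                   ≡⟨ cong₂ _,_ (identity₁ a c) (identity₁ a b) ⟩
    (+ 0 , + 0)                                                      ∎
    where
    open ≡.≡-Reasoning
    identity₁ : ∀ a c → a * + 0 + (+ 0 - c * + 0) ≡ + 0
    identity₁ = solve-∀

  module _ {m : ℕ} where

    private
      ≡²-sym : ∀ {r s} → r ≡² s [mod m ] → s ≡² r [mod m ]
      ≡²-sym (r₀≡s₀ , r₁≡s₁) = ≡ₘ-sym r₀≡s₀ , ≡ₘ-sym r₁≡s₁

      ≡²-trans : ∀ {r s t} → r ≡² s [mod m ] → s ≡² t [mod m ] → r ≡² t [mod m ]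
      ≡²-trans (r₀≡s₀ , r₁≡s₁) (s₀≡t₀ , s₁≡t₁) = ≡ₘ-trans r₀≡s₀ s₀≡t₀ , ≡ₘ-trans r₁≡s₁ s₁≡t₁

    horner-congₘ : ∀ {a a′ r s} → a ≡ a′ [mod m ] → r ≡² s [mod m ] → horner b c a r ≡² horner b c a′ s [mod m ]
    horner-congₘ a≡a′ (r₀≡s₀ , r₁≡s₁) =
      +-congₘ a≡a′ (-‿congₘ (*-congₘ (≡ₘ-refl {a = c}) r₁≡s₁)) ,
      +-congₘ r₀≡s₀ (-‿congₘ (*-congₘ (≡ₘ-refl {a = b}) r₁≡s₁))

    remainder-vanishesₘ : ∀ p → p ≋ [] [mod m ] → remainder b c p ≡² (+ 0 , + 0) [mod m ]
    remainder-vanishesₘ []      _   = ≡ₘ-refl , ≡ₘ-refl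
    remainder-vanishesₘ (a ∷ p) p≋0 = ≡²-trans
      (horner-congₘ (coeff-≡ₘ p≋0 0) (remainder-vanishesₘ p (coeffwise λ i → coeff-≡ₘ p≋0 (suc i))))
      (≡⇒≡ₘ (identity c) , ≡⇒≡ₘ (identity b))
      where
      identity : ∀ c → + 0 - c * + 0 ≡ + 0
      identity = solve-∀

    remainder-congₘ : ∀ p q → p ≋ q [mod m ] → remainder b c p ≡² remainder b c q [mod m ]
    remainder-congₘ []      q        p≋q = ≡²-sym (remainder-vanishesₘ q (≋-sym p≋q))
    remainder-congₘ (a ∷ p) []       p≋q = remainder-vanishesₘ (a ∷ p) p≋q
    remainder-congₘ (a ∷ p) (a′ ∷ q) p≋q =
      horner-congₘ (coeff-≡ₘ p≋q 0) (remainder-congₘ p q (coeffwise λ i → coeff-≡ₘ p≋q (suc i)))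

    quad-∣⇔remainder≡0 : ∀ {g} → f ∣ₚ g [mod m ] ⇔ remainder b c g ≡² (+ 0 , + 0) [mod m ]
    quad-∣⇔remainder≡0 {g} = mk⇔ to from
      where
      to : f ∣ₚ g [mod m ] → remainder b c g ≡² (+ 0 , + 0) [mod m ]
      to (h , g≈h⊗f) = subst (λ r → remainder b c g ≡² r [mod m ]) (remainder-⊗quad h)
        (remainder-congₘ g (h ⊗ f) (≈⇒≋ g≈h⊗f))

      from : remainder b c g ≡² (+ 0 , + 0) [mod m ] → f ∣ₚ g [mod m ]
      from (r₀≡0 , r₁≡0) = quotient b c g , ≋⇒≈ {p = g} {q = quotient b c g ⊗ f} (coeffwise λ i → begin
        coeff g i                                         ≡⟨ division g i ⟩
        coeff (Q ⊗ f) i + coeff (linear (remainder b c g)) i  ≈⟨ +-congₘ (≡ₘ-refl {a = coeff (Q ⊗ f) i}) (linear≡0 i) ⟩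
        coeff (Q ⊗ f) i + + 0                             ≡⟨ ℤ.+-identityʳ (coeff (Q ⊗ f) i) ⟩
        coeff (Q ⊗ f) i                                   ∎)
        where
        open SetoidReasoning (≡ₘ-setoid m)
        Q = quotient b c g
        linear≡0 : ∀ i → coeff (linear (remainder b c g)) i ≡ + 0 [mod m ]
        linear≡0 zero          = r₀≡0
        linear≡0 (suc zero)    = r₁≡0
        linear≡0 (suc (suc i)) = ≡ₘ-refl

frobenius⇒quad-∣ : ∀ {n b c} → FrobPsp2 n b c → jacobi (disc b c) n ≡ + 1 →
  quad b c ∣ₚ (xpow n ⊖ xpow 1) [mod n ]
frobenius⇒quad-∣ {n} {b} {c}
  (composite , _ , F₁ , f₁ , F₂ , f₂ , ((d , F₁-monic) , _ , (q , g≈q⊗F₁) , _) ,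
   f≈F₁⊗f₁ , _ , f₁≈F₂⊗f₂ , f₂≈one , _ , k , F₂-monic , [-1]^k≡jacobi) jacobi≡1 =
  q , ≋⇒≈ (begin
    xpow n ⊖ xpow 1  ≈⟨ ≈⇒≋ g≈q⊗F₁ ⟩
    q ⊗ F₁           ≈⟨ ⊗-congʳₘ q (≋-sym f≋F₁) ⟩
    q ⊗ f            ∎)
  where
  open SetoidReasoning (≋-setoid n)
  f = quad b c

  f≋F₁⊗F₂ : f ≋ F₁ ⊗ F₂ [mod n ]
  f≋F₁⊗F₂ = begin
    f              ≈⟨ ≈⇒≋ f≈F₁⊗f₁ ⟩
    F₁ ⊗ f₁        ≈⟨ ⊗-congʳₘ F₁ (≈⇒≋ f₁≈F₂⊗f₂) ⟩
    F₁ ⊗ (F₂ ⊗ f₂) ≈⟨ ⊗-congʳₘ F₁ (⊗-congʳₘ F₂ (≈⇒≋ f₂≈one)) ⟩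
    F₁ ⊗ (F₂ ⊗ one) ≈⟨ ⊗-congʳₘ F₁ (⊗-identityʳ F₂) ⟩
    F₁ ⊗ F₂        ∎

  F₂≋one : ∀ k → MonicDeg n F₂ (2 ℕ.* k) → -[1+ 0 ] ℤ.^ k ≡ jacobi (disc b c) n → F₂ ≋ one [mod n ]
  F₂≋one zero          F₂-monic _ = monic₀⇒≋one F₂-monic
  F₂≋one (suc zero)    _        [-1]≡jacobi with ≡.trans [-1]≡jacobi jacobi≡1
  ... | ()
  F₂≋one (suc (suc k)) F₂-monic _ =
    ⊥-elim (ℕ.nonTrivial⇒≢1 {{composite⇒nonTrivial composite}} (0≡1⇒m≡1 0≡1))
    where
    D = d ℕ.+ 2 ℕ.* suc (suc k)
    2<D : 2 ℕ.< D
    2<D = ℕ.≤-trans (ℕ.n≤1+n 3) (ℕ.≤-trans (ℕ.*-monoʳ-≤ 2 (ℕ.s≤s (ℕ.s≤s ℕ.z≤n))) (ℕ.m≤n+m _ d))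
    0≡1 : + 0 ≡ + 1 [mod n ]
    0≡1 = ≡ₘ-trans (≡ₘ-sym (≡ᶻ⇒≡ (proj₂ (quad-monic b c) D 2<D)))
            (≡ₘ-trans (coeff-≡ₘ f≋F₁⊗F₂ D) (leading-⊗ F₁ F₂ F₁-monic F₂-monic))

  f≋F₁ : f ≋ F₁ [mod n ]
  f≋F₁ = begin
    f        ≈⟨ f≋F₁⊗F₂ ⟩
    F₁ ⊗ F₂  ≈⟨ ⊗-congʳₘ F₁ (F₂≋one k F₂-monic [-1]^k≡jacobi) ⟩
    F₁ ⊗ one ≈⟨ ⊗-identityʳ F₁ ⟩
    F₁       ∎

prime-factor : ∀ {t} → 1 ℕ.< t → ∃ λ p → Prime p × p ∣ t
prime-factor {suc zero} (ℕ.s≤s ())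
prime-factor {t@(suc (suc _))} _ with factorise t
... | record { factors = [] ; isFactorisation = () }
... | record { factors = p ∷ ps ; isFactorisation = t≡p*Πps ; factorsPrime = p-prime ∷ _ } =
  p , p-prime , subst (p ∣_) (≡.sym t≡p*Πps) (ℕ.m∣m*n (product ps))

exact-power : ∀ {p} → 1 ℕ.< p → ∀ n → n ≢ 0 → ∃ λ r → p ^ r ∣ n × ¬ (p ^ suc r ∣ n)
exact-power {p} 1<p = <-rec _ go
  where
  instance
    p-nonZero : ℕ.NonZero p
    p-nonZero = ℕ.>-nonZero (ℕ.<-trans (ℕ.s≤s ℕ.z≤n) 1<p)

  go : ∀ n → (∀ {q} → q ℕ.< n → q ≢ 0 → ∃ λ r → p ^ r ∣ q × ¬ (p ^ suc r ∣ q)) →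
       n ≢ 0 → ∃ λ r → p ^ r ∣ n × ¬ (p ^ suc r ∣ n)
  go n rec n≢0 with p ℕ.∣? n
  ... | no p∤n = 0 , ℕ.1∣ n , λ p*1∣n → p∤n (subst (_∣ n) (ℕ.*-identityʳ p) p*1∣n)
  ... | yes (ℕ.divides q refl) with rec q<q*p q≢0
    where
    q≢0 : q ≢ 0
    q≢0 refl = n≢0 refl
    q<q*p : q ℕ.< q ℕ.* p
    q<q*p = ℕ.m<m*n q p {{ℕ.≢-nonZero q≢0}} 1<p
  ... | r , pʳ∣q , pʳ⁺¹∤q =
    suc r ,
    subst (_∣ q ℕ.* p) (ℕ.*-comm (p ^ r) p) (ℕ.*-monoˡ-∣ p pʳ∣q) ,
    λ pʳ⁺²∣q*p → pʳ⁺¹∤q (ℕ.*-cancelʳ-∣ p (subst (_∣ q ℕ.* p) (ℕ.*-comm p (p ^ suc r)) pʳ⁺²∣q*p))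

AtExactPrimePowers : ℕ → (ℕ → Set) → Set
AtExactPrimePowers n P = ∀ p r → Prime p → p ∣ n → p ^ r ∣ n → ¬ (p ^ suc r ∣ n) → P (p ^ r)

-- If t = n / gcd n x had a prime factor p, then with pʳ ∥ n also pʳ ∣ gcd n x, so pʳ⁺¹ ∣ t * gcd n x = n.
∣-local-global : ∀ {n x} → n ≢ 0 → AtExactPrimePowers n (_∣ x) → n ∣ x
∣-local-global {n} {x} n≢0 local with ℕ.gcd[m,n]∣m n x
... | ℕ.divides zero n≡0 = ⊥-elim (n≢0 n≡0)
... | ℕ.divides (suc zero) n≡g+0 =
  subst (_∣ x) (≡.sym (≡.trans n≡g+0 (ℕ.+-identityʳ _))) (ℕ.gcd[m,n]∣n n x)
... | ℕ.divides t@(suc (suc _)) n≡t*g with prime-factor {t} (ℕ.s≤s (ℕ.s≤s ℕ.z≤n))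
... | p , p-prime , p∣t with exact-power (ℕ.nonTrivial⇒n>1 p {{prime⇒nonTrivial p-prime}}) n n≢0
... | r , pʳ∣n , pʳ⁺¹∤n = ⊥-elim (pʳ⁺¹∤n pʳ⁺¹∣n)
  where
  p∣n : p ∣ n
  p∣n = ℕ.∣-trans p∣t (ℕ.divides (ℕ.gcd n x) (≡.trans n≡t*g (ℕ.*-comm t (ℕ.gcd n x))))
  pʳ⁺¹∣n : p ^ suc r ∣ n
  pʳ⁺¹∣n = subst (p ^ suc r ∣_) (≡.sym n≡t*g)
    (ℕ.*-pres-∣ p∣t (ℕ.gcd-greatest pʳ∣n (local p r p-prime p∣n pʳ∣n pʳ⁺¹∤n)))

≡0ₘ-local-global : ∀ {n a} → n ≢ 0 → AtExactPrimePowers n (λ q → a ≡ + 0 [mod q ]) → a ≡ + 0 [mod n ]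
≡0ₘ-local-global {a = a} n≢0 local =
  Equivalence.from (≡0ₘ⇔∣ a) (∣-local-global n≢0 λ p r p-prime p∣n pʳ∣n pʳ⁺¹∤n →
    Equivalence.to (≡0ₘ⇔∣ a) (local p r p-prime p∣n pʳ∣n pʳ⁺¹∤n))

quad-∣⇔local-Gcmd : ∀ {n b c g} → n ≢ 0 →
  quad b c ∣ₚ g [mod n ] ⇔ AtExactPrimePowers n (λ q → Gcmd q g (quad b c) (quad b c))
quad-∣⇔local-Gcmd {n} {b} {c} {g} n≢0 = mk⇔
  (λ f∣g p r _ _ pʳ∣n _ → Gcmd-self (2 , quad-monic b c) (∣ₚ-weaken {g = g} {h = quad b c} pʳ∣n f∣g))
  (λ local → Equivalence.from (quad-∣⇔remainder≡0 {b} {c} {n} {g})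
    ( ≡0ₘ-local-global n≢0 (λ p r p-prime p∣n pʳ∣n pʳ⁺¹∤n → proj₁ (remainder≡0 (local p r p-prime p∣n pʳ∣n pʳ⁺¹∤n)))
    , ≡0ₘ-local-global n≢0 (λ p r p-prime p∣n pʳ∣n pʳ⁺¹∤n → proj₂ (remainder≡0 (local p r p-prime p∣n pʳ∣n pʳ⁺¹∤n)))))
  where
  remainder≡0 : ∀ {q} → Gcmd q g (quad b c) (quad b c) → remainder b c g ≡² (+ 0 , + 0) [mod q ]
  remainder≡0 {q} (_ , _ , f∣g , _) = Equivalence.to (quad-∣⇔remainder≡0 {b} {c} {q} {g}) f∣g

coprime-via-primes : ∀ {n k} → (∀ p → Prime p → p ∣ n → ¬ (p ∣ k)) → Coprime n k
coprime-via-primes {n} {k} no-common-prime {zero} (0∣n , 0∣k) =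
  ⊥-elim (no-common-prime 2 prime[2] (subst (2 ∣_) (≡.sym (ℕ.0∣⇒≡0 0∣n)) (2 ℕ.∣0))
                                     (subst (2 ∣_) (≡.sym (ℕ.0∣⇒≡0 0∣k)) (2 ℕ.∣0)))
coprime-via-primes no-common-prime {suc zero} _ = refl
coprime-via-primes no-common-prime {i@(suc (suc _))} (i∣n , i∣k) with prime-factor {i} (ℕ.s≤s (ℕ.s≤s ℕ.z≤n))
... | p , p-prime , p∣i = ⊥-elim (no-common-prime p p-prime (ℕ.∣-trans p∣i i∣n) (ℕ.∣-trans p∣i i∣k))

private
  pos-1+*≡* : ∀ a b c d → 1 ℕ.+ a ℕ.* b ≡ c ℕ.* d → + 1 + + a * + b ≡ + c * + d
  pos-1+*≡* a b c d eq = begin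
    + 1 + + a * + b    ≡⟨ cong (_+_ (+ 1)) (ℤ.pos-* a b) ⟨
    + 1 + + (a ℕ.* b)  ≡⟨ ℤ.pos-+ 1 (a ℕ.* b) ⟨
    + (1 ℕ.+ a ℕ.* b)  ≡⟨ cong +_ eq ⟩
    + (c ℕ.* d)        ≡⟨ ℤ.pos-* c d ⟩
    + c * + d          ∎
    where open ≡.≡-Reasoning

bézout-inverse : ∀ {n K} → Coprime n K → ∃ λ v → + K * v ≡ + 1 [mod n ]
bézout-inverse {n} {K} coprime with coprime-Bézout coprime
... | Bézout.+- x y 1+yK≡xn = - + y , ≡ₘ-intro (- + x) (begin
  + K * - + y - + 1    ≡⟨ identity₁ (+ K) (+ y) ⟩
  - (+ 1 + + y * + K)  ≡⟨ cong -_ (pos-1+*≡* y K x n 1+yK≡xn) ⟩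
  - (+ x * + n)        ≡⟨ ℤ.neg-distribˡ-* (+ x) (+ n) ⟩
  - + x * + n          ∎)
  where
  open ≡.≡-Reasoning
  identity₁ : ∀ k y → k * - y - + 1 ≡ - (+ 1 + y * k)
  identity₁ = solve-∀
... | Bézout.-+ x y 1+xn≡yK = + y , ≡ₘ-intro (+ x) (begin
  + K * + y - + 1              ≡⟨ cong (_- + 1) (ℤ.*-comm (+ K) (+ y)) ⟩
  + y * + K - + 1              ≡⟨ cong (_- + 1) (pos-1+*≡* x n y K 1+xn≡yK) ⟨
  (+ 1 + + x * + n) - + 1      ≡⟨ identity₂ (+ x * + n) ⟩
  + x * + n                    ∎)
  where
  open ≡.≡-Reasoning
  identity₂ : ∀ z → (+ 1 + z) - + 1 ≡ z
  identity₂ = solve-∀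

coprime⇒invertible : ∀ {n} d → Coprime n ℤ.∣ d ∣ → ∃ λ u → d * u ≡ + 1 [mod n ]
coprime⇒invertible (+ K)    coprime = bézout-inverse coprime
coprime⇒invertible -[1+ k ] coprime with bézout-inverse coprime
... | v , Kv≡1 = - v , ≡ₘ-trans (≡⇒≡ₘ (identity (+ suc k) v)) Kv≡1
  where
  identity : ∀ k v → - k * - v ≡ k * v
  identity = solve-∀

private
  prime≢1 : ∀ {p} → Prime p → p ≢ 1
  prime≢1 p-prime = ℕ.nonTrivial⇒≢1 {{prime⇒nonTrivial p-prime}}

coprime⇔invertible×nonzero : ∀ {n} a d →
  Coprime n ℤ.∣ a * d ∣ ⇔
  ((∃ λ u → d * u ≡ᶻ + 1 [mod n ]) × (∀ p → Prime p → p ∣ n → ¬ (a ≡ᶻ + 0 [mod p ])))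
coprime⇔invertible×nonzero {n} a d = mk⇔ to from
  where
  ∣a*d∣≡∣a∣*∣d∣ : ℤ.∣ a * d ∣ ≡ ℤ.∣ a ∣ ℕ.* ℤ.∣ d ∣
  ∣a*d∣≡∣a∣*∣d∣ = ℤ.abs-* a d

  to : Coprime n ℤ.∣ a * d ∣ →
       (∃ λ u → d * u ≡ᶻ + 1 [mod n ]) × (∀ p → Prime p → p ∣ n → ¬ (a ≡ᶻ + 0 [mod p ]))
  to coprime = map₂ ≡⇒≡ᶻ (coprime⇒invertible d coprime-d) , nonzero
    where
    coprime-d : Coprime n ℤ.∣ d ∣
    coprime-d (e∣n , e∣d) = coprime (e∣n , subst (_ ∣_) (≡.sym ∣a*d∣≡∣a∣*∣d∣) (ℕ.∣-trans e∣d (ℕ.n∣m*n ℤ.∣ a ∣)))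
    nonzero : ∀ p → Prime p → p ∣ n → ¬ (a ≡ᶻ + 0 [mod p ])
    nonzero p p-prime p∣n a≡0 = prime≢1 p-prime (coprime (p∣n ,
      subst (p ∣_) (≡.sym ∣a*d∣≡∣a∣*∣d∣) (ℕ.∣-trans (Equivalence.to (≡0ₘ⇔∣ a) (≡ᶻ⇒≡ a≡0)) (ℕ.m∣m*n ℤ.∣ d ∣))))

  from : (∃ λ u → d * u ≡ᶻ + 1 [mod n ]) × (∀ p → Prime p → p ∣ n → ¬ (a ≡ᶻ + 0 [mod p ])) →
         Coprime n ℤ.∣ a * d ∣
  from ((u , du≡1) , nonzero) = coprime-via-primes no-common-prime
    where
    no-common-prime : ∀ p → Prime p → p ∣ n → ¬ (p ∣ ℤ.∣ a * d ∣)
    no-common-prime p p-prime p∣n p∣ad =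
      [ (λ p∣a → nonzero p p-prime p∣n (≡⇒≡ᶻ (Equivalence.from (≡0ₘ⇔∣ a) p∣a)))
      , (λ p∣d → prime≢1 p-prime (0≡1⇒m≡1 (begin
          + 0      ≈⟨ *-congₘ (Equivalence.from (≡0ₘ⇔∣ d) p∣d) (≡ₘ-refl {a = u}) ⟨
          d * u    ≈⟨ ≡ₘ-weaken p∣n (≡ᶻ⇒≡ du≡1) ⟩
          + 1      ∎)))
      ]′ (euclidsLemma ℤ.∣ a ∣ ℤ.∣ d ∣ p-prime (subst (p ∣_) ∣a*d∣≡∣a∣*∣d∣ p∣ad))
      where open SetoidReasoning (≡ₘ-setoid p)

frobenius⇔coprime×quad-∣ : ∀ {n b c} → Composite n → jacobi (disc b c) n ≡ + 1 →
  FrobPsp2 n b c ⇔ (Coprime n ℤ.∣ c * disc b c ∣ × quad b c ∣ₚ (xpow n ⊖ xpow 1) [mod n ])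
frobenius⇔coprime×quad-∣ {n} {b} {c} composite jacobi≡1 = mk⇔
  (λ frob → proj₁ (proj₂ frob) , frobenius⇒quad-∣ frob jacobi≡1)
  (λ (coprime , f∣g) → composite , coprime , quad b c , one , one , one ,
     Gcmd-self (2 , quad-monic b c) f∣g ,
     ≋⇒≈ (≋-sym (⊗-identityʳ (quad b c))) ,
     Gcmd-self (0 , one-monic) (one-∣ₚ (xpow (n ℕ.* n) ⊖ xpow 1)) ,
     ≋⇒≈ (≋-sym (⊗-identityʳ one)) ,
     ≋⇒≈ (≋-refl {p = one}) ,
     one-∣ₚ (compose one (xpow n)) ,
     0 , one-monic , ≡.sym jacobi≡1)

proposition2p4 : (n : ℕ) (b c : ℤ) → Composite n → ¬ (2 ∣ n) →
    jacobi (disc b c) n ≡ + 1 →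
    FrobPsp2 n b c ⇔
      (((∃ λ u → disc b c * u ≡ᶻ + 1 [mod n ]) ×
        (∀ p → Prime p → p ∣ n → ¬ (c ≡ᶻ + 0 [mod p ]))) ×
       (∀ p r → Prime p → p ∣ n → (p ^ r) ∣ n → ¬ ((p ^ suc r) ∣ n) →
          Gcmd (p ^ r) (xpow n ⊖ xpow 1) (quad b c) (quad b c)))
proposition2p4 n b c composite _ jacobi≡1 =
  (coprime⇔invertible×nonzero c (disc b c) ×-⇔ quad-∣⇔local-Gcmd n≢0)
    ⇔-∘ frobenius⇔coprime×quad-∣ composite jacobi≡1
  where
  n≢0 : n ≢ 0
  n≢0 = ℕ.≢-nonZero⁻¹ n {{composite⇒nonZero composite}}
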